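{- The Diophantine equation $$x(x+1)y(y+1)=z(z+1)(z+2)(z+3)$$ has infinitely many solutions in positive integers $x,y,z$ satisfying $(z-x)(z-x+2)\neq 0$. -}

module Defs where

open import Data.Nat using (ℕ; suc; _+_; _*_; _<_)
open import Data.Product using (_×_; ∃-syntax)
open import Relation.Binary.PropositionalEquality using (_≡_)
open import Relation.Nullary using (¬_)

-- (x,y,z) is a solution in positive integers of
--   x(x+1)y(y+1) = z(z+1)(z+2)(z+3)
-- with (z-x)(z-x+2) ≠ 0, i.e. z ≠ x and z + 2 ≠ x (over ℤ).
Sol : ℕ → ℕ → ℕ → Set
Sol x y z =
  (0 < x) × (0 < y) × (0 < z) ×
  (x * (x + 1) * (y * (y + 1)) ≡ z * (z + 1) * (z + 2) * (z + 3)) ×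
  (¬ (z ≡ x)) × (¬ (z + 2 ≡ x))

-- The solution set is infinite: it is unbounded (for every N there is a
-- solution with x + y + z > N); for triples of naturals this is equivalent
-- to infinitude.
InfinitelyManySolutions : Set
InfinitelyManySolutions = ∀ (N : ℕ) → ∃[ x ] ∃[ y ] ∃[ z ] (Sol x y z × N < x + y + z)

{-# OPTIONS --safe #-}
-- If 2a(a+1) = c(c+2), then x = a, y = 3a + 2c + 3, z = a + c solve the
-- equation: the difference x(x+1)y(y+1) − z(z+1)(z+2)(z+3) is a polynomial
-- multiple of 2a(a+1) − c(c+2). The condition says u² − 2v² = −1 for
-- u = 2a + 1, v = c + 1, so the fundamental unit 3 + 2√2 of ℤ[√2] produces
-- infinitely many such pairs (a, c), starting from (3, 4).
module Submission where

open import Defs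
open import Data.Nat
open import Data.Nat.Properties
open import Data.Nat.Tactic.RingSolver using (solve-∀)
open import Data.Product using (_×_; _,_; ∃-syntax)
open import Relation.Binary.PropositionalEquality
open ≡-Reasoning

PellPair : ℕ → ℕ → Set
PellPair a c = 2 * (a * (a + 1)) ≡ c * (c + 2)

pellPair-next-identity : ∀ a c →
  let a′ = 3 * a + 2 * c + 3 ; c′ = 4 * a + 3 * c + 4 in
  2 * (a′ * (a′ + 1)) + c * (c + 2) ≡ c′ * (c′ + 2) + 2 * (a * (a + 1))
pellPair-next-identity = solve-∀

pellPair-next : ∀ {a c} → PellPair a c → PellPair (3 * a + 2 * c + 3) (4 * a + 3 * c + 4)
pellPair-next {a} {c} pell = +-cancelʳ-≡ (c * (c + 2)) _ _ (begin
  2 * (a′ * (a′ + 1)) + c * (c + 2)  ≡⟨ pellPair-next-identity a c ⟩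
  c′ * (c′ + 2) + 2 * (a * (a + 1))  ≡⟨ cong (c′ * (c′ + 2) +_) pell ⟩
  c′ * (c′ + 2) + c * (c + 2)        ∎)
  where
  a′ = 3 * a + 2 * c + 3
  c′ = 4 * a + 3 * c + 4

-- x(x+1)y(y+1) − z(z+1)(z+2)(z+3) = q (2a(a+1) − c(c+2)), rearranged to avoid subtraction.
solution-identity : ∀ a c →
  let y = 3 * a + 2 * c + 3 ; z = a + c ; q = (2 * a + c + 1) * (2 * a + c + 3) in
  a * (a + 1) * (y * (y + 1)) + q * (c * (c + 2))
    ≡ z * (z + 1) * (z + 2) * (z + 3) + q * (2 * (a * (a + 1)))
solution-identity = solve-∀

pellPair⇒solution : ∀ {a c} → PellPair a c →
  let y = 3 * a + 2 * c + 3 ; z = a + c in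
  a * (a + 1) * (y * (y + 1)) ≡ z * (z + 1) * (z + 2) * (z + 3)
pellPair⇒solution {a} {c} pell = +-cancelʳ-≡ (q * (c * (c + 2))) _ _ (begin
  a * (a + 1) * (y * (y + 1)) + q * (c * (c + 2))   ≡⟨ solution-identity a c ⟩
  z * (z + 1) * (z + 2) * (z + 3) + q * (2 * (a * (a + 1)))
    ≡⟨ cong (λ t → z * (z + 1) * (z + 2) * (z + 3) + q * t) pell ⟩
  z * (z + 1) * (z + 2) * (z + 3) + q * (c * (c + 2)) ∎)
  where
  y = 3 * a + 2 * c + 3
  z = a + c
  q = (2 * a + c + 1) * (2 * a + c + 3)

pellPair⇒Sol : ∀ {a c} → PellPair a c → 0 < a → 0 < c → Sol a (3 * a + 2 * c + 3) (a + c)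
pellPair⇒Sol {a} {c} pell 0<a 0<c =
  0<a , <-≤-trans 0<1+n (m≤n+m 3 (3 * a + 2 * c)) , <-≤-trans 0<a (m≤m+n a c) , pellPair⇒solution {a} {c} pell ,
  (λ a+c≡a → <-irrefl (sym a+c≡a) (m<m+n a 0<c)) ,
  (λ a+c+2≡a → <-irrefl (sym a+c+2≡a) (≤-<-trans (m≤m+n a c) (m<m+n (a + c) 0<1+n)))

pellPairs-unbounded : ∀ N → ∃[ a ] ∃[ c ] PellPair a c × N < a × 0 < c
pellPairs-unbounded zero = 3 , 4 , refl , 0<1+n , 0<1+n
pellPairs-unbounded (suc N) with pellPairs-unbounded N
... | a , c , pell , N<a , _ =
  3 * a + 2 * c + 3 , 4 * a + 3 * c + 4 , pellPair-next {a} {c} pell ,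
  ≤-<-trans N<a a<a′ , <-≤-trans 0<1+n (m≤n+m 4 (4 * a + 3 * c))
  where
  a<a′ : a < 3 * a + 2 * c + 3
  a<a′ = <-≤-trans (m<m+n a {3} 0<1+n) (+-monoˡ-≤ 3 (≤-trans (m≤n*m a 3) (m≤m+n (3 * a) (2 * c))))

theorem2p3 : InfinitelyManySolutions
theorem2p3 N with pellPairs-unbounded N
... | a , c , pell , N<a , 0<c =
  a , 3 * a + 2 * c + 3 , a + c ,
  pellPair⇒Sol pell (≤-<-trans z≤n N<a) 0<c ,
  <-≤-trans N<a (≤-trans (m≤m+n a _) (m≤m+n _ (a + c)))
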